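{- During any run of the algorithm Lazy-Move-All-To-Front (LMA) on an Exponential Caching input all of whose requested sets have cardinality at most $r$, and for any valid partitioning $p^*$ taken as the comparison partitioning, at every moment between the elementary operations of LMA (budget increases and fetch operations) it holds that $\Phi_z\ge 0$ for every element $z\in U$.
   Context: Exponential Caching: universe $U$ with $|U|=2^w-1$; with $[w]=\{0,\dots,w-1\}$, a partitioning $p:U\to[w]$ is valid if $|p^{ -1}(i)|=2^i$; chunks are $S_i=p^{ -1}(i)$. Requests are nonempty sets $R\subseteq U$. Algorithm LMA maintains a valid partitioning $p$ and a budget $b(z)$ for each $z\in U$, initially $0$. Routine fetch$(z)$: if $\ell=p(z)>0$, for $i=0,\dots,\ell-1$ pick $a_i$ uniformly at random from $S_i$ (current chunks), then move $z$ from $S_\ell$ to $S_0$ and move each $a_i$ from $S_i$ to $S_{i+1}$; in all cases set $b(z)\gets0$. On request $R$: let $x\in R$ minimize $p(x)$ and let $\ell=p(x)$ (its chunk index at the time of the request); pay access cost $2^{\ell}$; execute fetch$(x)$; for every $y\in R\setminus\{x\}$ set $b(y)\gets b(y)+2^{\ell}$; then, while some $z$ has $b(z)\ge 2^{p(z)}$, execute fetch$(z)$. Potential: with $\alpha=7$, $\gamma=7r-6$, $\beta=21r-11$, $\kappa=\lceil\log_2\beta\rceil$, for LMA's current $p,b$ and a valid partitioning $p^*$, $\Phi_z=\alpha\, b(z)$ if $p(z)\le p^*(z)+\kappa$ and $\Phi_z=\beta\,2^{p(z)}-\gamma\, b(z)$ if $p(z)\ge p^*(z)+\kappa+1$. 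-}

module Defs where

open import Data.Nat as ℕ using (ℕ; zero; suc; _+_; _*_; _∸_; _^_; _≤_; _<_)
open import Data.Nat.Logarithm using (⌈log₂_⌉)
open import Data.Bool using (Bool; true; false; if_then_else_)
open import Data.Fin as Fin using (Fin; toℕ)
open import Data.Integer as ℤ using (ℤ; +_)
open import Data.Product using (Σ; ∃; _×_; _,_)
open import Relation.Binary.PropositionalEquality using (_≡_; _≢_)
open import Relation.Nullary.Decidable using (⌊_⌋; does)

count : ∀ {n} → (Fin n → Bool) → ℕ
count {zero}  P = 0
count {suc n} P = (if P Fin.zero then 1 else 0) + count (λ i → P (Fin.suc i))

U : ℕ → Set
U w = Fin (2 ^ w ∸ 1)

Partitioning : ℕ → Set
Partitioning w = U w → Fin w

Valid : ∀ {w} → Partitioning w → Set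
Valid {w} p = (i : Fin w) → count (λ z → ⌊ p z Fin.≟ i ⌋) ≡ 2 ^ toℕ i

Budget : ℕ → Set
Budget w = U w → ℕ

Subset : ℕ → Set
Subset w = U w → Bool

-- fetch(z) as a relation from (p , b) to (p' , b'), for a choice of the random
-- elements a_i ∈ S_i (i < ℓ = p(z)), all taken from the chunks current at the
-- start of the fetch.
record Fetch (w : ℕ) (p : Partitioning w) (b : Budget w) (z : U w)
             (p' : Partitioning w) (b' : Budget w) : Set where
  field
    a        : (i : Fin w) → toℕ i < toℕ (p z) → U w
    a-chunk  : ∀ i (h : toℕ i < toℕ (p z)) → p (a i h) ≡ i
    p'-z     : toℕ (p' z) ≡ 0
    p'-a     : ∀ i (h : toℕ i < toℕ (p z)) → toℕ (p' (a i h)) ≡ suc (toℕ i)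
    p'-other : ∀ y → y ≢ z → (∀ i (h : toℕ i < toℕ (p z)) → y ≢ a i h) → p' y ≡ p y
    b'-z     : b' z ≡ 0
    b'-other : ∀ y → y ≢ z → b' y ≡ b y

-- Control phase of LMA: idle (between requests), or busy processing a request,
-- with the set of elements whose budget still has to be increased by `amt`.
data Phase (w : ℕ) : Set where
  idle : Phase w
  busy : (pending : Subset w) (amt : ℕ) → Phase w

record Config (w : ℕ) : Set where
  constructor ⟨_,_,_⟩
  field
    part   : Partitioning w
    budget : Budget w
    phase  : Phase w

NoPending : (w : ℕ) → Subset w → Set
NoPending w pend = ∀ y → pend y ≡ false

data Step {w : ℕ} (r : ℕ) : Config w → Config w → Set where
  -- a new request R arrives: x ∈ R minimizes p, fetch(x); then budgets of
  -- R \ {x} are to be increased by 2^{p(x)} (p(x) taken before the fetch)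
  request : ∀ {p b p' b'} (R : Subset w) (x : U w) →
            count R ≤ r →
            R x ≡ true →
            (∀ y → R y ≡ true → toℕ (p x) ≤ toℕ (p y)) →
            Fetch w p b x p' b' →
            Step r ⟨ p , b , idle ⟩
                   ⟨ p' , b' , busy (λ y → if ⌊ y Fin.≟ x ⌋ then false else R y)
                                    (2 ^ toℕ (p x)) ⟩
  increase : ∀ {p b pend amt} (y : U w) → pend y ≡ true →
             Step r ⟨ p , b , busy pend amt ⟩
                    ⟨ p , (λ z → if ⌊ z Fin.≟ y ⌋ then b z + amt else b z)
                        , busy (λ z → if ⌊ z Fin.≟ y ⌋ then false else pend z) amt ⟩
  overflow : ∀ {p b p' b' pend amt} (z : U w) → NoPending w pend →
             2 ^ toℕ (p z) ≤ b z →
             Fetch w p b z p' b' →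
             Step r ⟨ p , b , busy pend amt ⟩ ⟨ p' , b' , busy pend amt ⟩
  finish : ∀ {p b pend amt} → NoPending w pend →
           (∀ z → b z < 2 ^ toℕ (p z)) →
           Step r ⟨ p , b , busy pend amt ⟩ ⟨ p , b , idle ⟩

data Reachable {w : ℕ} (r : ℕ) : Config w → Set where
  start : (p : Partitioning w) → Valid p → Reachable r ⟨ p , (λ _ → 0) , idle ⟩
  step  : ∀ {c c'} → Reachable r c → Step r c c' → Reachable r c'

α γ β : ℕ → ℤ
α r = + 7
γ r = + 7 ℤ.* + r ℤ.- + 6
β r = + 21 ℤ.* + r ℤ.- + 11

κ : ℕ → ℕ
κ r = ⌈log₂ (21 * r ∸ 11) ⌉

Φ : (w r : ℕ) (p* p : Partitioning w) (b : Budget w) (z : U w) → ℤ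
Φ w r p* p b z =
  if ⌊ toℕ (p z) ℕ.≤? toℕ (p* z) + κ r ⌋
  then α r ℤ.* + b z
  else β r ℤ.* + (2 ^ toℕ (p z)) ℤ.- γ r ℤ.* + b z

-- Every reachable configuration of LMA satisfies b(z) ≤ 2·2^{p(z)}: between
-- requests even b(z) < 2^{p(z)} (otherwise the while loop would still run), a
-- request adds 2^{p(x)} ≤ 2^{p(y)} to each other requested y, and fetches never
-- move an element other than the fetched one to a lower chunk. Since
-- 2γ = 14r − 12 ≤ 21r − 11 = β, the bound b ≤ 2·2^p makes β·2^p − γ·b ≥ 0,
-- and the other branch α·b of Φ is trivially nonnegative.
module Submission where

open import Defs
open import Data.Nat using (ℕ; _≤_)
open import Data.Integer using (+_) renaming (_≤_ to _≤ℤ_)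

open import Data.Nat using (suc; _+_; _*_; _^_; _<_; _<?_; _≤?_; z≤n; s≤s)
open import Data.Nat.Properties
  using (module ≤-Reasoning; ≤-reflexive; ≤-trans; <⇒≤; n≤1+n; m≤m+n; +-mono-≤;
         *-monoˡ-≤; *-monoʳ-≤; ^-monoʳ-≤; *-suc; *-identityˡ; <-irrelevant)
open import Data.Nat.Tactic.RingSolver using (solve)
open import Data.Integer as ℤ using (_⊖_)
open import Data.Integer.Properties using (pos-*; +-cancelˡ-⊖; i≤j⇒0≤j-i)
open import Data.Bool using (true; false; if_then_else_)
open import Data.Fin as Fin using (toℕ)
open import Data.List using (_∷_; [])
open import Data.Product using (_×_; _,_; proj₁)
open import Relation.Nullary using (yes; no)
open import Relation.Nullary.Decidable using (⌊_⌋)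
open import Function using (case_of_)
open import Relation.Binary.PropositionalEquality

BudgetBound : ∀ {w} → ℕ → Partitioning w → Budget w → Set
BudgetBound k p b = ∀ z → b z ≤ k * 2 ^ toℕ (p z)

module _ {w p b z p' b'} (F : Fetch w p b z p' b') where
  open Fetch F

  sample-chunk : ∀ {y i h} → y ≡ a i h → p y ≡ i
  sample-chunk {i = i} {h} y≡a = trans (cong p y≡a) (a-chunk i h)

  fetch-part-≤ : ∀ y → y ≢ z → toℕ (p y) ≤ toℕ (p' y)
  fetch-part-≤ y y≢z with toℕ (p y) <? toℕ (p z)
  ... | no py≮pz = ≤-reflexive (cong toℕ (sym (p'-other y y≢z y≢a)))
    where
    y≢a : ∀ i h → y ≢ a i h
    y≢a i h y≡a = py≮pz (subst (λ j → toℕ j < toℕ (p z)) (sym (sample-chunk y≡a)) h)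
  ... | yes py<pz with y Fin.≟ a (p y) py<pz
  ...   | yes y≡a = ≤-trans (n≤1+n _)
                      (≤-reflexive (sym (trans (cong (λ v → toℕ (p' v)) y≡a) (p'-a (p y) py<pz))))
  ...   | no y≢a₍py₎ = ≤-reflexive (cong toℕ (sym (p'-other y y≢z y≢a)))
    where
    -- a sample equal to y must be the one drawn from y's own chunk
    y≢a : ∀ i h → y ≢ a i h
    y≢a i h y≡a with sample-chunk y≡a
    ... | refl = y≢a₍py₎ (trans y≡a (cong (a i) (<-irrelevant h py<pz)))

  fetch-preserves-bound : ∀ k → BudgetBound k p b → BudgetBound k p' b'
  fetch-preserves-bound k bound y with y Fin.≟ z
  ... | yes refl = subst (_≤ _) (sym b'-z) z≤n
  ... | no y≢z = subst (_≤ _) (sym (b'-other y y≢z))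
                   (≤-trans (bound y) (*-monoʳ-≤ k (^-monoʳ-≤ 2 (fetch-part-≤ y y≢z))))

Invariant : ∀ {w} → Config w → Set
Invariant ⟨ p , b , idle ⟩ = BudgetBound 1 p b
Invariant ⟨ p , b , busy pending amt ⟩ =
  BudgetBound 2 p b × (∀ z → pending z ≡ true → b z + amt ≤ 2 * 2 ^ toℕ (p z))

BudgetBound-1⇒2 : ∀ {w} {p : Partitioning w} {b} → BudgetBound 1 p b → BudgetBound 2 p b
BudgetBound-1⇒2 bound z = ≤-trans (bound z) (*-monoˡ-≤ _ {1} {2} (s≤s z≤n))

Invariant⇒BudgetBound : ∀ {w} (c : Config w) → Invariant c →
                        BudgetBound 2 (Config.part c) (Config.budget c)
Invariant⇒BudgetBound ⟨ p , b , idle ⟩ = BudgetBound-1⇒2 {p = p}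
Invariant⇒BudgetBound ⟨ p , b , busy _ _ ⟩ = proj₁

request-preserves-invariant : ∀ {w p b p' b'} (R : Subset w) (x : U w) →
  (∀ y → R y ≡ true → toℕ (p x) ≤ toℕ (p y)) → Fetch w p b x p' b' →
  Invariant ⟨ p , b , idle ⟩ →
  Invariant {w} ⟨ p' , b' , busy (λ y → if ⌊ y Fin.≟ x ⌋ then false else R y) (2 ^ toℕ (p x)) ⟩
request-preserves-invariant {p = p} {b} {p'} {b'} R x x-min F bound =
  BudgetBound-1⇒2 {p = p'} bound' , pending-bound
  where
  bound' : BudgetBound 1 p' b'
  bound' = fetch-preserves-bound F 1 bound
  pending-bound : ∀ y → (if ⌊ y Fin.≟ x ⌋ then false else R y) ≡ true →
                  b' y + 2 ^ toℕ (p x) ≤ 2 * 2 ^ toℕ (p' y)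
  pending-bound y Ry with y Fin.≟ x
  pending-bound y () | yes _
  pending-bound y Ry | no y≢x =
    +-mono-≤ (subst (b' y ≤_) (*-identityˡ _) (bound' y))
             (≤-trans (^-monoʳ-≤ 2 (≤-trans (x-min y Ry) (fetch-part-≤ F y y≢x)))
                      (m≤m+n _ 0))

module _ {w r : ℕ} where

  step-preserves-invariant : ∀ {c c' : Config w} → Step r c c' → Invariant c → Invariant c'
  step-preserves-invariant (request R x _ _ x-min F) = request-preserves-invariant R x x-min F
  step-preserves-invariant {⟨ p , b , busy pending amt ⟩} (increase y pending-y)
                           (bound , pending-bound) = bound' , pending-bound'
    where
    bound' : BudgetBound 2 p (λ z → if ⌊ z Fin.≟ y ⌋ then b z + amt else b z)
    bound' z with z Fin.≟ y
    ... | yes refl = pending-bound z pending-y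
    ... | no _ = bound z
    pending-bound' : ∀ z → (if ⌊ z Fin.≟ y ⌋ then false else pending z) ≡ true →
                     (if ⌊ z Fin.≟ y ⌋ then b z + amt else b z) + amt ≤ 2 * 2 ^ toℕ (p z)
    pending-bound' z pz with z Fin.≟ y
    pending-bound' z () | yes _
    pending-bound' z pz | no _ = pending-bound z pz
  step-preserves-invariant (overflow z none-pending _ F) (bound , _) =
    fetch-preserves-bound F 2 bound ,
    λ y pending-y → case trans (sym pending-y) (none-pending y) of λ ()
  step-preserves-invariant (finish _ below) _ z =
    subst (_ ≤_) (sym (*-identityˡ _)) (<⇒≤ (below z))

  reachable⇒invariant : ∀ {c : Config w} → Reachable r c → Invariant c
  reachable⇒invariant (start _ _) _ = z≤n
  reachable⇒invariant (step c-reachable s) =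
    step-preserves-invariant s (reachable⇒invariant c-reachable)

γ-suc : ∀ r → γ (suc r) ≡ + (1 + 7 * r)
γ-suc r = begin
  (7 * suc r) ⊖ 6              ≡⟨ cong (_⊖ 6) (*-suc 7 r) ⟩
  (6 + (1 + 7 * r)) ⊖ (6 + 0)  ≡⟨ +-cancelˡ-⊖ 6 (1 + 7 * r) 0 ⟩
  + (1 + 7 * r)                ∎
  where open ≡-Reasoning

β-suc : ∀ r → β (suc r) ≡ + (10 + 21 * r)
β-suc r = begin
  (21 * suc r) ⊖ 11              ≡⟨ cong (_⊖ 11) (*-suc 21 r) ⟩
  (11 + (10 + 21 * r)) ⊖ (11 + 0) ≡⟨ +-cancelˡ-⊖ 11 (10 + 21 * r) 0 ⟩
  + (10 + 21 * r)                 ∎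
  where open ≡-Reasoning

0≤m*k-n*l : ∀ m k n l → n * l ≤ m * k → + 0 ≤ℤ + m ℤ.* + k ℤ.- + n ℤ.* + l
0≤m*k-n*l m k n l nl≤mk =
  subst₂ (λ u v → + 0 ≤ℤ u ℤ.- v) (pos-* m k) (pos-* n l) (i≤j⇒0≤j-i (ℤ.+≤+ nl≤mk))

b≤2K⇒[1+7r]b≤[10+21r]K : ∀ r b K → b ≤ 2 * K → (1 + 7 * r) * b ≤ (10 + 21 * r) * K
b≤2K⇒[1+7r]b≤[10+21r]K r b K b≤2K = begin
  (1 + 7 * r) * b        ≤⟨ *-monoʳ-≤ (1 + 7 * r) b≤2K ⟩
  (1 + 7 * r) * (2 * K)  ≡⟨ solve (r ∷ K ∷ []) ⟩
  (2 + 14 * r) * K       ≤⟨ *-monoˡ-≤ K 2+14r≤10+21r ⟩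
  (10 + 21 * r) * K      ∎
  where
  open ≤-Reasoning
  2+14r≤10+21r : 2 + 14 * r ≤ 10 + 21 * r
  2+14r≤10+21r = +-mono-≤ {2} {10} (s≤s (s≤s z≤n)) (*-monoˡ-≤ r {14} {21} (m≤m+n 14 7))

Φ-nonneg : ∀ {w} r (p* p : Partitioning w) (b : Budget w) z →
           b z ≤ 2 * 2 ^ toℕ (p z) → + 0 ≤ℤ Φ w (suc r) p* p b z
Φ-nonneg r p* p b z b≤2K with toℕ (p z) ≤? toℕ (p* z) + κ (suc r)
... | yes _ = subst (+ 0 ≤ℤ_) (pos-* 7 (b z)) (ℤ.+≤+ z≤n)
... | no  _ = subst₂ (λ β′ γ′ → + 0 ≤ℤ β′ ℤ.* + K ℤ.- γ′ ℤ.* + b z)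
                     (sym (β-suc r)) (sym (γ-suc r))
                     (0≤m*k-n*l (10 + 21 * r) K (1 + 7 * r) (b z)
                                 (b≤2K⇒[1+7r]b≤[10+21r]K r (b z) K b≤2K))
  where K = 2 ^ toℕ (p z)

corollary1 : (w r : ℕ) → 1 ≤ r →
    (c : Config w) → Reachable r c →
    (p* : Partitioning w) → Valid p* →
    (z : U w) → + 0 ≤ℤ Φ w r p* (Config.part c) (Config.budget c) z
corollary1 w (suc r) _ c c-reachable p* _ z =
  Φ-nonneg r p* (Config.part c) (Config.budget c) z
    (Invariant⇒BudgetBound c (reachable⇒invariant c-reachable) z)
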